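{- Let $n\ge1$ and let $\sigma\in C_{2n}(123)$ be such that $\Phi(\sigma)$ is a Dyck path. Then $$\mathrm{des}(\sigma)=2(k_1+k_2)+1,$$ where $k_1$ is the number of triple falls of $\Phi(\sigma)$ and $k_2$ is the number of valleys of $\Phi(\sigma)$.
   Context: $C_{2n}(123)$ is the set of permutations $\sigma$ of $[2n]=\{1,\dots,2n\}$ with $\sigma(i)+\sigma(2n+1-i)=2n+1$ for all $i$ and no $i<j<k$ with $\sigma(i)<\sigma(j)<\sigma(k)$. $\mathrm{des}(\sigma)$ is the number of $i$ with $\sigma(i)>\sigma(i+1)$. A Dyck prefix of length $m$ is a word in $U=(1,1)$, $D=(1,-1)$ of length $m$ whose lattice path from the origin never goes below the $x$-axis; it is a Dyck path if it ends on the $x$-axis. A triple fall of a path is an index $i$ such that steps $i,i+1,i+2$ are all $D$ (occurrences of $DDD$, counted with overlaps); a valley is an index $i$ such that step $i$ is $D$ and step $i+1$ is $U$. For a set $S=\{s_1<\dots<s_r\}$ and a permutation $\tau$ of $[r]$, the word on $S$ order-isomorphic to $\tau$ is $s_{\tau(1)}\cdots s_{\tau(r)}$. Define $\Psi$ recursively from Dyck prefixes of length $2n$ to permutations of $[2n]$: the empty prefix goes to the empty permutation; for nonempty $\pi=U^jD^k\pi'$ ($j\ge1,k\ge0$ maximal), $\sigma=\Psi(\pi)$ is: (a) if $j\le n$: $\sigma(1)=2n+1-j$, $\sigma(i)=2n+2-i$ ($2\le i\le k$), $\sigma(2n)=j$, $\sigma(2n-i)=i$ ($1\le i\le k-1$),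 and $\sigma(k+1)\cdots\sigma(2n-k)$ is the word on $[2n]\setminus\{1,\dots,k-1,j,2n+1-j,2n-k+2,\dots,2n\}$ order-isomorphic to $\Psi(U^{j-k}\pi')$; (b) if $j=n+1$: $\sigma(1)=n$, $\sigma(i)=2n+2-i$ ($2\le i\le k+1$), $\sigma(2n)=n+1$, $\sigma(2n-i)=i$ ($1\le i\le k$), and $\sigma(k+2)\cdots\sigma(2n-k-1)$ is the word on $[2n]\setminus\{1,\dots,k,n,n+1,2n-k+1,\dots,2n\}$ order-isomorphic to $\Psi(U^{n-k-1}\pi')$; (c) if $j\ge n+2$: $\sigma(1)=n$, $\sigma(2n)=n+1$, and $\sigma(2)\cdots\sigma(2n-1)$ is the word on $[2n]\setminus\{n,n+1\}$ order-isomorphic to $\Psi(U^{j-2}D^k\pi')$. The paper shows $\Psi$ is a bijection onto $C_{2n}(123)$; $\Phi$ denotes its inverse. -}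

module Defs where

open import Data.Nat using (ℕ; zero; suc; _+_; _*_; _∸_; _≤_; _<_; _≤ᵇ_; _≡ᵇ_; _<ᵇ_)
open import Data.Bool using (Bool; true; false; if_then_else_; _∧_; not)
open import Data.List using (List; []; _∷_; _++_; map; filter; replicate; reverse; length)
open import Data.Product using (_×_; ∃)
open import Relation.Nullary using (¬_)
open import Relation.Binary.PropositionalEquality using (_≡_)
open import Data.List.Relation.Binary.Permutation.Propositional using (_↭_)
open import Relation.Nullary.Decidable using (does)
open import Data.Bool.Properties using (T?)

-- Lattice-path steps U = (1,1), D = (1,-1)

data Step : Set where
  U D : Step

-- DyckFrom h e w : the path w, started at height h, never goes below
-- the x-axis and ends at height e.
data DyckFrom : ℕ → ℕ → List Step → Set where
  done : ∀ {h} → DyckFrom h h []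
  up   : ∀ {h e w} → DyckFrom (suc h) e w → DyckFrom h e (U ∷ w)
  down : ∀ {h e w} → DyckFrom h e w → DyckFrom (suc h) e (D ∷ w)

DyckPrefix : List Step → Set
DyckPrefix w = ∃ λ e → DyckFrom 0 e w

DyckPath : List Step → Set
DyckPath w = DyckFrom 0 0 w

-- number of indices i with steps i, i+1, i+2 all D (overlaps counted)
tripleFalls : List Step → ℕ
tripleFalls (D ∷ D ∷ D ∷ w) = suc (tripleFalls (D ∷ D ∷ w))
tripleFalls (_ ∷ w) = tripleFalls w
tripleFalls [] = 0

valleys : List Step → ℕ
valleys (D ∷ U ∷ w) = suc (valleys (U ∷ w))
valleys (_ ∷ w) = valleys w
valleys [] = 0

-- Permutations of [m] as words σ(1) σ(2) ... σ(m) (lists of naturals)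

-- [a, a+1, ..., b]  (empty if b < a)
rangeLen : ℕ → ℕ → List ℕ
rangeLen a zero = []
rangeLen a (suc l) = a ∷ rangeLen (suc a) l

range : ℕ → ℕ → List ℕ
range a b = rangeLen a (suc b ∸ a)

-- 0-indexed lookup with default 0
nth : List ℕ → ℕ → ℕ
nth [] _ = 0
nth (x ∷ xs) zero = x
nth (x ∷ xs) (suc i) = nth xs i

-- 1-indexed value σ(i)
at : List ℕ → ℕ → ℕ
at σ i = nth σ (i ∸ 1)

des : List ℕ → ℕ
des (x ∷ y ∷ xs) = (if y <ᵇ x then 1 else 0) + des (y ∷ xs)
des _ = 0

IsPerm : ℕ → List ℕ → Set
IsPerm m σ = σ ↭ range 1 m

Centrosymmetric : ℕ → List ℕ → Set
Centrosymmetric m σ = ∀ i → 1 ≤ i → i ≤ m → at σ i + at σ (suc m ∸ i) ≡ suc m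

Avoids123 : ℕ → List ℕ → Set
Avoids123 m σ = ∀ i j k → 1 ≤ i → i < j → j < k → k ≤ m →
                ¬ (at σ i < at σ j × at σ j < at σ k)

record InC (m : ℕ) (σ : List ℕ) : Set where
  field
    perm    : IsPerm m σ
    centro  : Centrosymmetric m σ
    avoid   : Avoids123 m σ

leadU : List Step → ℕ
leadU (U ∷ w) = suc (leadU w)
leadU _ = 0

leadD : List Step → ℕ
leadD (D ∷ w) = suc (leadD w)
leadD _ = 0

dropN : ℕ → List Step → List Step
dropN zero w = w
dropN (suc k) [] = []
dropN (suc k) (_ ∷ w) = dropN k w

-- the word on S (sorted ascending list) order-isomorphic to τ (a word on [r])
embed : List ℕ → List ℕ → List ℕ
embed S τ = map (λ t → nth S (t ∸ 1)) τ

keep : ℕ → ℕ → ℕ → ℕ → ℕ → List ℕ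
keep m a b x y = filter (λ v → T? ((a ≤ᵇ v) ∧ (v ≤ᵇ b) ∧ not (v ≡ᵇ x) ∧ not (v ≡ᵇ y))) (range 1 m)

-- psiF fuel n π : Ψ applied to a Dyck prefix π of length 2n.
-- The fuel only serves termination; Ψ uses fuel n+1, which suffices
-- since each recursive call lowers n by at least 1.
psiF : ℕ → ℕ → List Step → List ℕ
psiF zero n π = []
psiF (suc f) n [] = []
psiF (suc f) n (s ∷ π0) =
  let π = s ∷ π0
      j = leadU π
      rest = dropN j π
      k = leadD rest
      π' = dropN k rest
      m = n + n
  in if j ≤ᵇ n then
       ((suc m ∸ j) ∷ map (λ i → suc (suc m) ∸ i) (range 2 k))
       ++ embed (keep m k (suc m ∸ k) j (suc m ∸ j))
                (psiF f (n ∸ k) (replicate (j ∸ k) U ++ π'))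
       ++ (reverse (range 1 (k ∸ 1)) ++ (j ∷ []))
     else if j ≡ᵇ suc n then
       (n ∷ map (λ i → suc (suc m) ∸ i) (range 2 (suc k)))
       ++ embed (keep m (suc k) (m ∸ k) n (suc n))
                (psiF f (n ∸ k ∸ 1) (replicate (n ∸ k ∸ 1) U ++ π'))
       ++ (reverse (range 1 k) ++ (suc n ∷ []))
     else
       (n ∷ [])
       ++ embed (keep m 1 m n (suc n))
                (psiF f (n ∸ 1) (replicate (j ∸ 2) U ++ replicate k D ++ π'))
       ++ (suc n ∷ [])

Ψ : ℕ → List Step → List ℕ
Ψ n π = psiF (suc n) n π

-- Cut π at its first peak: π = U^j D^k π′ with j = k′ + a + 1, k = k′ + 1 and π′ a path
-- from height a of length a + 2d, so that n = k′ + a + d + 1 (`peakView`).  Hence j ≤ n,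
-- Ψ is in case (a), and Ψ(π) is the frame
--   Y, 2n, …, 2n − k′ + 1, [τ placed on S], k′, …, 1, J        (J = j, Y = 2n + 1 − j)
-- with τ = Ψ(U^a π′) placed order-isomorphically on S = [k′ + 1, 2n − k′] ∖ {J, Y}
-- (`Ψ-peak`, `Frame.caseA-frame`).  Counting descents run by run, an empty frame has
-- 2(k′ ∸ 1) + 1 descents and a nonempty one 2(k′ ∸ 1) + 2 + des τ, because τ starts
-- below Y and ends above J.  On the path side the fall D^k holds k′ ∸ 1 triple falls and,
-- when π′ is nonempty, ends in one valley.  Induction on the recursion depth (`Ψ-good`)
-- carries the formula together with the end letters and the range of Ψ (record `Good`).
module Submission where

open import Defs
open import Data.Nat using (ℕ; zero; suc; _+_; _*_; _∸_; _≤_; _<_; _≤ᵇ_; _<ᵇ_; _≡ᵇ_; z≤n; s≤s)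
open import Data.Nat.Properties
open import Data.Nat.Tactic.RingSolver using (solve-∀)
open import Data.Bool using (Bool; true; false; if_then_else_; _∧_; not; T)
open import Data.Bool.Properties using (T?; T-∧; T-≡)
open import Data.List using (List; []; _∷_; _++_; map; filter; replicate; reverse; length)
open import Data.List.Properties using (map-++; length-++; ++-assoc; ++-identityʳ; unfold-reverse; length-replicate; filter-++; filter-all; filter-none; filter-reject)
open import Data.List.Relation.Unary.All as All using (All; []; _∷_)
open import Data.List.Relation.Unary.All.Properties using (++⁺; map⁺; all-filter)
open import Data.List.Relation.Unary.Linked using (Linked; []; [-]; _∷_)
open import Data.List.Relation.Unary.Linked.Properties using (Linked⇒All; filter⁺)
open import Data.Product using (Σ; _×_; _,_; proj₁; proj₂)
open import Data.Sum using (_⊎_; inj₁; inj₂)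
open import Data.Empty using (⊥-elim)
open import Data.Unit using (tt)
open import Function.Bundles using (Equivalence)
open import Relation.Binary.PropositionalEquality using (_≡_; _≢_; refl; sym; trans; cong; cong₂; subst; module ≡-Reasoning)
open import Relation.Binary.Definitions using (tri<; tri≈; tri>)
open import Relation.Nullary using (¬_)

bit : Bool → ℕ
bit b = if b then 1 else 0

bit-< : ∀ {p q} → p < q → bit (p <ᵇ q) ≡ 1
bit-< {p} {q} p<q with p <ᵇ q in eq
... | true  = refl
... | false = ⊥-elim (subst T eq (<⇒<ᵇ p<q))

bit-≥ : ∀ {p q} → q ≤ p → bit (p <ᵇ q) ≡ 0
bit-≥ {p} {q} q≤p with p <ᵇ q in eq
... | false = refl
... | true  = ⊥-elim (<⇒≱ (<ᵇ⇒< p q (subst T (sym eq) tt)) q≤p)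

lastOr : ℕ → List ℕ → ℕ
lastOr x []       = x
lastOr _ (y ∷ ys) = lastOr y ys

lastOr-snoc : ∀ x xs y → lastOr x (xs ++ y ∷ []) ≡ y
lastOr-snoc x []       y = refl
lastOr-snoc x (z ∷ zs) y = lastOr-snoc z zs y

des-++ : ∀ x xs y ys →
         des ((x ∷ xs) ++ y ∷ ys) ≡ des (x ∷ xs) + bit (y <ᵇ lastOr x xs) + des (y ∷ ys)
des-++ x []       y ys = refl
des-++ x (z ∷ zs) y ys =
  trans (cong (bit (z <ᵇ x) +_) (des-++ z zs y ys)) (regroup (bit (z <ᵇ x)) _ _ _)
  where
  regroup : ∀ p q r s → p + (q + r + s) ≡ p + q + r + s
  regroup = solve-∀

downRun : ℕ → ℕ → List ℕ
downRun b zero    = []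
downRun b (suc l) = (b + l) ∷ downRun b l

des-down-++ : ∀ b l y ys → des (downRun b (suc l) ++ y ∷ ys) ≡ l + bit (y <ᵇ b) + des (y ∷ ys)
des-down-++ b zero    y ys rewrite +-identityʳ b = refl
des-down-++ b (suc l) y ys =
  cong₂ _+_ (bit-< (+-monoʳ-< b (n<1+n l))) (des-down-++ b l y ys)

des-closing : ∀ k J → 1 ≤ J → des (downRun 1 k ++ J ∷ []) ≡ k ∸ 1
des-closing zero    J _   = refl
des-closing (suc k) J 1≤J = begin
  des (downRun 1 (suc k) ++ J ∷ [])  ≡⟨ des-down-++ 1 k J [] ⟩
  k + bit (J <ᵇ 1) + 0            ≡⟨ cong (λ c → k + c + 0) (bit-≥ 1≤J) ⟩
  k + 0 + 0                       ≡⟨ trans (+-identityʳ _) (+-identityʳ k) ⟩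
  k                               ∎
  where open ≡-Reasoning

des-openRun : ∀ Y B k y ys → Y ≤ B → y < Y →
              des (Y ∷ downRun B k ++ y ∷ ys) ≡ (k ∸ 1) + 1 + des (y ∷ ys)
des-openRun Y B zero    y ys _   y<Y = cong (_+ des (y ∷ ys)) (bit-< y<Y)
des-openRun Y B (suc k) y ys Y≤B y<Y = begin
  bit ((B + k) <ᵇ Y) + des (downRun B (suc k) ++ y ∷ ys)
    ≡⟨ cong₂ _+_ (bit-≥ (≤-trans Y≤B (m≤m+n B k))) (des-down-++ B k y ys) ⟩
  0 + (k + bit (y <ᵇ B) + des (y ∷ ys))
    ≡⟨ cong (λ c → k + c + des (y ∷ ys)) (bit-< (<-≤-trans y<Y Y≤B)) ⟩
  k + 1 + des (y ∷ ys) ∎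
  where open ≡-Reasoning

des-closeRun : ∀ x xs k J → k ≤ J → J < lastOr x xs →
               des ((x ∷ xs) ++ downRun 1 k ++ J ∷ []) ≡ des (x ∷ xs) + 1 + (k ∸ 1)
des-closeRun x xs zero J _ J<last = begin
  des ((x ∷ xs) ++ J ∷ [])                      ≡⟨ des-++ x xs J [] ⟩
  des (x ∷ xs) + bit (J <ᵇ lastOr x xs) + 0     ≡⟨ cong (λ c → des (x ∷ xs) + c + 0) (bit-< J<last) ⟩
  des (x ∷ xs) + 1 + 0                          ∎
  where open ≡-Reasoning
des-closeRun x xs (suc k) J k<J J<last = begin
  des ((x ∷ xs) ++ downRun 1 (suc k) ++ J ∷ [])
    ≡⟨ des-++ x xs (suc k) (downRun 1 k ++ J ∷ []) ⟩
  des (x ∷ xs) + bit (suc k <ᵇ lastOr x xs) + des (downRun 1 (suc k) ++ J ∷ [])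
    ≡⟨ cong₂ (λ c e → des (x ∷ xs) + c + e) (bit-< (≤-<-trans k<J J<last))
             (des-closing (suc k) J (≤-trans (s≤s z≤n) k<J)) ⟩
  des (x ∷ xs) + 1 + k ∎
  where open ≡-Reasoning

des-emptyFrame : ∀ Y B k J → Y ≤ B → J < Y → k ≤ J →
                 des (Y ∷ downRun B k ++ downRun 1 k ++ J ∷ []) ≡ 2 * (k ∸ 1) + 1
des-emptyFrame Y B zero    J _   J<Y _   = cong (_+ 0) (bit-< J<Y)
des-emptyFrame Y B (suc k) J Y≤B J<Y k<J = begin
  des (Y ∷ downRun B (suc k) ++ suc k ∷ downRun 1 k ++ J ∷ [])
    ≡⟨ des-openRun Y B (suc k) (suc k) _ Y≤B (≤-<-trans k<J J<Y) ⟩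
  k + 1 + des (downRun 1 (suc k) ++ J ∷ [])
    ≡⟨ cong (k + 1 +_) (des-closing (suc k) J (≤-trans (s≤s z≤n) k<J)) ⟩
  k + 1 + k
    ≡⟨ twice k ⟩
  2 * k + 1 ∎
  where
  open ≡-Reasoning
  twice : ∀ k → k + 1 + k ≡ 2 * k + 1
  twice = solve-∀

des-relabel : ∀ (P : ℕ → Set) (f : ℕ → ℕ) → (∀ {s t} → P s → P t → s < t → f s < f t) →
              ∀ {τ} → All P τ → des (map f τ) ≡ des τ
des-relabel P f mono []            = refl
des-relabel P f mono (_ ∷ [])      = refl
des-relabel P f mono {x ∷ y ∷ τ} (px ∷ py ∷ pτ) = cong₂ _+_ sameBit (des-relabel P f mono (py ∷ pτ))
  where
  sameBit : bit (f y <ᵇ f x) ≡ bit (y <ᵇ x)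
  sameBit with <-cmp y x
  ... | tri< y<x _ _ = trans (bit-< (mono py px y<x)) (sym (bit-< y<x))
  ... | tri≈ _ refl _ = trans (bit-≥ (≤-refl {f x})) (sym (bit-≥ (≤-refl {x})))
  ... | tri> _ _ x<y = trans (bit-≥ (<⇒≤ (mono px py x<y))) (sym (bit-≥ (<⇒≤ x<y)))

rangeLen-++ : ∀ b p q → rangeLen b (p + q) ≡ rangeLen b p ++ rangeLen (b + p) q
rangeLen-++ b zero    q = cong (λ c → rangeLen c q) (sym (+-identityʳ b))
rangeLen-++ b (suc p) q =
  cong (b ∷_) (trans (rangeLen-++ (suc b) p q) (cong (λ c → rangeLen (suc b) p ++ rangeLen c q) (sym (+-suc b p))))

length-rangeLen : ∀ b l → length (rangeLen b l) ≡ l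
length-rangeLen b zero    = refl
length-rangeLen b (suc l) = cong suc (length-rangeLen (suc b) l)

nth-rangeLen : ∀ b l i → i < l → nth (rangeLen b l) i ≡ b + i
nth-rangeLen b (suc l) zero    _       = sym (+-identityʳ b)
nth-rangeLen b (suc l) (suc i) (s≤s i<l) = trans (nth-rangeLen (suc b) l i i<l) (sym (+-suc b i))

rangeLen-increasing : ∀ b l → Linked _<_ (rangeLen b l)
rangeLen-increasing b zero          = []
rangeLen-increasing b (suc zero)    = [-]
rangeLen-increasing b (suc (suc l)) = n<1+n b ∷ rangeLen-increasing (suc b) (suc l)

All-rangeLen : ∀ b l → All (λ v → b ≤ v × v < b + l) (rangeLen b l)
All-rangeLen b zero    = []
All-rangeLen b (suc l) =
  (≤-refl , subst (b <_) (sym (+-suc b l)) (s≤s (m≤m+n b l)))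
  ∷ All.map (λ {v} (b<v , v<) → <⇒≤ b<v , subst (v <_) (sym (+-suc b l)) v<) (All-rangeLen (suc b) l)

All-downRun : ∀ b l → All (λ v → b ≤ v × v < b + l) (downRun b l)
All-downRun b zero    = []
All-downRun b (suc l) =
  (m≤m+n b l , +-monoʳ-< b (n<1+n l))
  ∷ All.map (λ (b≤v , v<) → b≤v , <-trans v< (+-monoʳ-< b (n<1+n l))) (All-downRun b l)

downRun-snoc : ∀ b l → downRun (suc b) l ++ b ∷ [] ≡ downRun b (suc l)
downRun-snoc b zero    = cong (_∷ []) (sym (+-identityʳ b))
downRun-snoc b (suc l) = cong₂ _∷_ (sym (+-suc b l)) (downRun-snoc b l)

reverse-rangeLen : ∀ b l → reverse (rangeLen b l) ≡ downRun b l
reverse-rangeLen b zero    = refl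
reverse-rangeLen b (suc l) = begin
  reverse (b ∷ rangeLen (suc b) l)        ≡⟨ unfold-reverse b (rangeLen (suc b) l) ⟩
  reverse (rangeLen (suc b) l) ++ b ∷ []  ≡⟨ cong (_++ b ∷ []) (reverse-rangeLen (suc b) l) ⟩
  downRun (suc b) l ++ b ∷ []             ≡⟨ downRun-snoc b l ⟩
  downRun b (suc l)                       ∎
  where open ≡-Reasoning

reflect-rangeLen : ∀ N B b l → suc N ≡ B + (b + l) → map (λ i → N ∸ i) (rangeLen b l) ≡ downRun B l
reflect-rangeLen N B b zero    _  = refl
reflect-rangeLen N B b (suc l) eq = cong₂ _∷_ first (reflect-rangeLen N B (suc b) l eq′)
  where
  eq′ : suc N ≡ B + (suc b + l)
  eq′ = trans eq (cong (B +_) (+-suc b l))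
  shift : ∀ B b l → B + (b + suc l) ≡ suc (B + l + b)
  shift = solve-∀
  first : N ∸ b ≡ B + l
  first = trans (cong (_∸ b) (suc-injective (trans eq (shift B b l)))) (m+n∸n≡m (B + l) b)

nth-++ˡ : ∀ xs ys i → i < length xs → nth (xs ++ ys) i ≡ nth xs i
nth-++ˡ (x ∷ xs) ys zero    _         = refl
nth-++ˡ (x ∷ xs) ys (suc i) (s≤s i<n) = nth-++ˡ xs ys i i<n

nth-++ʳ : ∀ xs ys i → nth (xs ++ ys) (length xs + i) ≡ nth ys i
nth-++ʳ []       ys i = refl
nth-++ʳ (x ∷ xs) ys i = nth-++ʳ xs ys i

All-nth : ∀ {P : ℕ → Set} {xs} i → All P xs → i < length xs → P (nth xs i)
All-nth zero    (px ∷ _)  _         = px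
All-nth (suc i) (_ ∷ pxs) (s≤s i<n) = All-nth i pxs i<n

nth-increasing : ∀ {xs i j} → Linked _<_ xs → i < j → j < length xs → nth xs i < nth xs j
nth-increasing {x ∷ y ∷ ys} {zero}  {suc j} (x<y ∷ lk) _         (s≤s j<n) =
  All-nth j (Linked⇒All <-trans x<y lk) j<n
nth-increasing {x ∷ y ∷ ys} {suc i} {suc j} (_ ∷ lk)   (s≤s i<j) (s≤s j<n) =
  nth-increasing lk i<j j<n
nth-increasing {x ∷ []} {_} {suc j} [-] _ (s≤s ())

kept : ℕ → ℕ → ℕ → ℕ → ℕ → Bool
kept lo hi x y v = (lo ≤ᵇ v) ∧ (v ≤ᵇ hi) ∧ not (v ≡ᵇ x) ∧ not (v ≡ᵇ y)

T-not-≡ᵇ : ∀ {v x} → v ≢ x → T (not (v ≡ᵇ x))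
T-not-≡ᵇ {v} {x} v≢x with v ≡ᵇ x in eq
... | false = tt
... | true  = v≢x (≡ᵇ⇒≡ v x (subst T (sym eq) tt))

¬T-not-≡ᵇ : ∀ v → ¬ T (not (v ≡ᵇ v))
¬T-not-≡ᵇ v t with v ≡ᵇ v in eq
... | true  = t
... | false = subst T eq (≡⇒≡ᵇ v v refl)

kept-intro : ∀ lo hi x y {v} → lo ≤ v → v ≤ hi → v ≢ x → v ≢ y → T (kept lo hi x y v)
kept-intro lo hi x y lo≤v v≤hi v≢x v≢y = Equivalence.from T-∧
  (≤⇒≤ᵇ lo≤v , Equivalence.from T-∧ (≤⇒≤ᵇ v≤hi , Equivalence.from T-∧ (T-not-≡ᵇ v≢x , T-not-≡ᵇ v≢y)))

kept-elim : ∀ lo hi x y v → T (kept lo hi x y v) →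
            T (lo ≤ᵇ v) × T (v ≤ᵇ hi) × T (not (v ≡ᵇ x)) × T (not (v ≡ᵇ y))
kept-elim lo hi x y v t with Equivalence.to T-∧ t
... | t₁ , t′ with Equivalence.to T-∧ t′
... | t₂ , t″ with Equivalence.to T-∧ t″
... | t₃ , t₄ = t₁ , t₂ , t₃ , t₄

kept-bounds : ∀ lo hi x y v → T (kept lo hi x y v) → lo ≤ v × v ≤ hi
kept-bounds lo hi x y v t with kept-elim lo hi x y v t
... | t₁ , t₂ , _ = ≤ᵇ⇒≤ lo v t₁ , ≤ᵇ⇒≤ v hi t₂

keep-bounds : ∀ m lo hi x y → All (λ v → lo ≤ v × v ≤ hi) (keep m lo hi x y)
keep-bounds m lo hi x y = All.map (λ {v} → kept-bounds lo hi x y v) (all-filter (λ v → T? (kept lo hi x y v)) (range 1 m))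

keep-increasing : ∀ m lo hi x y → Linked _<_ (keep m lo hi x y)
keep-increasing m lo hi x y = filter⁺ (λ v → T? (kept lo hi x y v)) <-trans (rangeLen-increasing 1 m)

filter-kept-run : ∀ lo hi x y b l → (∀ {v} → b ≤ v → v < b + l → lo ≤ v × v ≤ hi × v ≢ x × v ≢ y) →
                  filter (λ v → T? (kept lo hi x y v)) (rangeLen b l) ≡ rangeLen b l
filter-kept-run lo hi x y b l inside =
  filter-all (λ v → T? (kept lo hi x y v))
    (All.map (λ (b≤v , v<) → let (lo≤v , v≤hi , v≢x , v≢y) = inside b≤v v< in kept-intro lo hi x y lo≤v v≤hi v≢x v≢y)
             (All-rangeLen b l))

filter-rejected-run : ∀ lo hi x y b l → (∀ {v} → b ≤ v → v < b + l → v < lo ⊎ hi < v) →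
                      filter (λ v → T? (kept lo hi x y v)) (rangeLen b l) ≡ []
filter-rejected-run lo hi x y b l outside =
  filter-none (λ v → T? (kept lo hi x y v)) (All.map (λ (b≤v , v<) → reject (outside b≤v v<)) (All-rangeLen b l))
  where
  reject : ∀ {v} → v < lo ⊎ hi < v → ¬ T (kept lo hi x y v)
  reject {v} (inj₁ v<lo) t = <⇒≱ v<lo (proj₁ (kept-bounds lo hi x y v t))
  reject {v} (inj₂ hi<v) t = <⇒≱ hi<v (proj₂ (kept-bounds lo hi x y v t))

rejects-x : ∀ lo hi x y → ¬ T (kept lo hi x y x)
rejects-x lo hi x y t = ¬T-not-≡ᵇ x (proj₁ (proj₂ (proj₂ (kept-elim lo hi x y x t))))

rejects-y : ∀ lo hi x y → ¬ T (kept lo hi x y y)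
rejects-y lo hi x y t = ¬T-not-≡ᵇ y (proj₂ (proj₂ (proj₂ (kept-elim lo hi x y y t))))

rangeLen-cut : ∀ {m x y hi} p a b c e → x ≡ suc p + a → y ≡ suc x + b → hi ≡ y + c → m ≡ hi + e →
               rangeLen 1 m ≡ rangeLen 1 p ++ rangeLen (suc p) a ++ x ∷ rangeLen (suc x) b ++
                              y ∷ rangeLen (suc y) c ++ rangeLen (suc hi) e
rangeLen-cut {m} {x} {y} p a b c e refl refl refl refl = begin
  rangeLen 1 m
    ≡⟨ cong (rangeLen 1) (sizes p a b c e) ⟩
  rangeLen 1 (p + (a + suc (b + suc (c + e))))
    ≡⟨ rangeLen-++ 1 p _ ⟩
  rangeLen 1 p ++ rangeLen (suc p) (a + suc (b + suc (c + e)))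
    ≡⟨ cong (rangeLen 1 p ++_) (rangeLen-++ (suc p) a _) ⟩
  rangeLen 1 p ++ rangeLen (suc p) a ++ x ∷ rangeLen (suc x) (b + suc (c + e))
    ≡⟨ cong (λ w → rangeLen 1 p ++ rangeLen (suc p) a ++ x ∷ w) (rangeLen-++ (suc x) b _) ⟩
  rangeLen 1 p ++ rangeLen (suc p) a ++ x ∷ rangeLen (suc x) b ++ y ∷ rangeLen (suc y) (c + e)
    ≡⟨ cong (λ w → rangeLen 1 p ++ rangeLen (suc p) a ++ x ∷ rangeLen (suc x) b ++ y ∷ w) (rangeLen-++ (suc y) c e) ⟩
  rangeLen 1 p ++ rangeLen (suc p) a ++ x ∷ rangeLen (suc x) b ++ y ∷ rangeLen (suc y) c ++ rangeLen (suc (y + c)) e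
    ∎
  where
  open ≡-Reasoning
  sizes : ∀ p a b c e → suc (suc p + a) + b + c + e ≡ p + (a + suc (b + suc (c + e)))
  sizes = solve-∀

keep-three-runs : ∀ {m x y hi} p a b c e → x ≡ suc p + a → y ≡ suc x + b → hi ≡ y + c → m ≡ hi + e →
                  keep m (suc p) hi x y ≡ rangeLen (suc p) a ++ rangeLen (suc x) b ++ rangeLen (suc y) c
keep-three-runs {m} {x} {y} {hi} p a b c e refl refl refl m≡ = begin
    filter K (rangeLen 1 m)
  ≡⟨ cong (filter K) (rangeLen-cut p a b c e refl refl refl m≡) ⟩
    filter K (below ++ runA ++ x ∷ runB ++ y ∷ runC ++ above)
  ≡⟨ filter-++ K below _ ⟩
    filter K below ++ filter K (runA ++ x ∷ runB ++ y ∷ runC ++ above)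
  ≡⟨ cong₂ _++_ (filter-rejected-run (suc p) hi x y 1 p (λ _ v<lo → inj₁ v<lo)) (filter-++ K runA _) ⟩
    filter K runA ++ filter K (x ∷ runB ++ y ∷ runC ++ above)
  ≡⟨ cong₂ _++_ (filter-kept-run (suc p) hi x y (suc p) a inA)
                (trans (filter-reject K {x} {runB ++ y ∷ runC ++ above} (rejects-x (suc p) hi x y)) (filter-++ K runB _)) ⟩
    runA ++ filter K runB ++ filter K (y ∷ runC ++ above)
  ≡⟨ cong (runA ++_) (cong₂ _++_ (filter-kept-run (suc p) hi x y (suc x) b inB)
                                 (trans (filter-reject K {y} {runC ++ above} (rejects-y (suc p) hi x y)) (filter-++ K runC _))) ⟩
    runA ++ runB ++ filter K runC ++ filter K above
  ≡⟨ cong (λ w → runA ++ runB ++ w)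
          (trans (cong₂ _++_ (filter-kept-run (suc p) hi x y (suc y) c inC)
                             (filter-rejected-run (suc p) hi x y (suc hi) e (λ hi<v _ → inj₂ hi<v)))
                 (++-identityʳ runC)) ⟩
    runA ++ runB ++ runC
  ∎
  where
  open ≡-Reasoning
  K = λ v → T? (kept (suc p) hi x y v)
  below = rangeLen 1 p
  runA  = rangeLen (suc p) a
  runB  = rangeLen (suc x) b
  runC  = rangeLen (suc y) c
  above = rangeLen (suc hi) e
  x<y : x < y
  x<y = s≤s (m≤m+n x b)
  y≤hi : y ≤ hi
  y≤hi = m≤m+n y c
  inA : ∀ {v} → suc p ≤ v → v < x → suc p ≤ v × v ≤ hi × v ≢ x × v ≢ y
  inA p≤v v<x = p≤v , ≤-trans (<⇒≤ (<-trans v<x x<y)) y≤hi , <⇒≢ v<x , <⇒≢ (<-trans v<x x<y)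
  inB : ∀ {v} → suc x ≤ v → v < y → suc p ≤ v × v ≤ hi × v ≢ x × v ≢ y
  inB x<v v<y = ≤-trans (m≤m+n (suc p) a) (<⇒≤ x<v) , ≤-trans (<⇒≤ v<y) y≤hi , >⇒≢ x<v , <⇒≢ v<y
  inC : ∀ {v} → suc y ≤ v → v < suc hi → suc p ≤ v × v ≤ hi × v ≢ x × v ≢ y
  inC y<v v≤hi = ≤-trans (m≤m+n (suc p) a) (<⇒≤ (<-trans x<y y<v)) , ≤-pred v≤hi , >⇒≢ (<-trans x<y y<v) , >⇒≢ y<v

data Falls : List Step → Set where
  falls : ∀ k π → leadD π ≡ 0 → Falls (replicate k D ++ π)

fallsOf : ∀ w → Falls w
fallsOf []      = falls 0 [] refl
fallsOf (U ∷ w) = falls 0 (U ∷ w) refl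
fallsOf (D ∷ w) with fallsOf w
... | falls k π noD = falls (suc k) π noD

data Runs : List Step → Set where
  runs : ∀ j k π → leadU (replicate k D ++ π) ≡ 0 → leadD π ≡ 0 →
         Runs (replicate j U ++ replicate k D ++ π)

runsOf : ∀ w → Runs w
runsOf []      = runs 0 0 [] refl refl
runsOf (D ∷ w) with fallsOf w
... | falls k π noD = runs 0 (suc k) π refl noD
runsOf (U ∷ w) with runsOf w
... | runs j k π noU noD = runs (suc j) k π noU noD

leadU-climb : ∀ j w → leadU (replicate j U ++ w) ≡ j + leadU w
leadU-climb zero    w = refl
leadU-climb (suc j) w = cong suc (leadU-climb j w)

leadU-run : ∀ j w → leadU w ≡ 0 → leadU (replicate j U ++ w) ≡ j
leadU-run j w noU = trans (leadU-climb j w) (trans (cong (j +_) noU) (+-identityʳ j))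

leadD-run : ∀ k w → leadD w ≡ 0 → leadD (replicate k D ++ w) ≡ k
leadD-run zero    w noD = noD
leadD-run (suc k) w noD = cong suc (leadD-run k w noD)

dropN-run : ∀ k s w → dropN k (replicate k s ++ w) ≡ w
dropN-run zero    s w = refl
dropN-run (suc k) s w = dropN-run k s w

length-runs : ∀ j k (π : List Step) → length (replicate j U ++ replicate k D ++ π) ≡ j + (k + length π)
length-runs j k π = begin
  length (replicate j U ++ replicate k D ++ π)      ≡⟨ length-++ (replicate j U) ⟩
  length (replicate j U) + length (replicate k D ++ π)
    ≡⟨ cong₂ _+_ (length-replicate j) (trans (length-++ (replicate k D)) (cong (_+ length π) (length-replicate k))) ⟩
  j + (k + length π)                                ∎
  where open ≡-Reasoning

dyck-climb : ∀ j {h e w} → DyckFrom h e (replicate j U ++ w) → DyckFrom (h + j) e w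
dyck-climb zero {h} p rewrite +-identityʳ h = p
dyck-climb (suc j) {h} {e} {w} (up p) = subst (λ z → DyckFrom z e w) (sym (+-suc h j)) (dyck-climb j p)

climb-dyck : ∀ j {h e w} → DyckFrom (h + j) e w → DyckFrom h e (replicate j U ++ w)
climb-dyck zero {h} p rewrite +-identityʳ h = p
climb-dyck (suc j) {h} {e} {w} p = up (climb-dyck j (subst (λ z → DyckFrom z e w) (+-suc h j) p))

dyck-fall : ∀ k {h e w} → DyckFrom h e (replicate k D ++ w) → Σ ℕ λ h′ → h ≡ k + h′ × DyckFrom h′ e w
dyck-fall zero {h} p = h , refl , p
dyck-fall (suc k) (down p) with dyck-fall k p
... | h′ , refl , q = h′ , refl , q

dyck-length : ∀ {h e w} → DyckFrom h e w → h ≤ length w + e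
dyck-length done     = ≤-refl
dyck-length (up p)   = m≤n⇒m≤1+n (≤-trans (n≤1+n _) (dyck-length p))
dyck-length (down p) = s≤s (dyck-length p)

half-≤ : ∀ {j n} → j + j ≤ n + n → j ≤ n
half-≤ le = ≮⇒≥ λ n<j → <⇒≱ (+-mono-< n<j n<j) le

leadU-half : ∀ {n ρ} → DyckPath ρ → length ρ ≡ n + n → leadU ρ ≤ n
leadU-half {n} {ρ} dy len with runsOf ρ
... | runs j k π noU _ = subst (_≤ n) (sym leadU≡j) (half-≤ (begin
    j + j                                 ≤⟨ +-monoʳ-≤ j (dyck-length (dyck-climb j dy)) ⟩
    j + (length r + 0)                    ≡⟨ cong (j +_) (+-identityʳ _) ⟩
    j + length r                          ≡⟨ cong (_+ length r) (sym (length-replicate j)) ⟩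
    length (replicate j U) + length r     ≡⟨ sym (length-++ (replicate j U)) ⟩
    length (replicate j U ++ r)           ≡⟨ len ⟩
    n + n                                 ∎))
  where
  open ≤-Reasoning
  r = replicate k D ++ π
  leadU≡j : leadU (replicate j U ++ r) ≡ j
  leadU≡j = leadU-run j r noU

-- The path U^(k′+a+1) D^(k′+1) π: a first peak at height k′ + a + 1, then a fall to height a.
peakPath : ℕ → ℕ → List Step → List Step
peakPath k′ a π = replicate (suc (k′ + a)) U ++ replicate (suc k′) D ++ π

leadU-peak : ∀ k′ a π → leadU (peakPath k′ a π) ≡ suc (k′ + a)
leadU-peak k′ a π = leadU-run (suc (k′ + a)) _ refl

-- A nonempty Dyck path of length 2n, cut at its first peak.  Writing the length of the
-- rest π as a + 2d exhibits the peak height j = k′ + a + 1 ≤ n, so Ψ is in case (a).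
data PeakView : ℕ → List Step → Set where
  peak : ∀ k′ a d π → DyckFrom a 0 π → length π ≡ a + (d + d) → leadD π ≡ 0 →
         PeakView (suc (k′ + a + d)) (peakPath k′ a π)

peak-length : ∀ k′ a d L → suc (k′ + a) + (suc k′ + L) ≡ suc (k′ + a + d) + suc (k′ + a + d) →
              L ≡ a + (d + d)
peak-length k′ a d L eq =
  +-cancelˡ-≡ (suc (k′ + a) + suc k′) L (a + (d + d))
    (trans (+-assoc (suc (k′ + a)) (suc k′) L) (trans eq (split k′ a d)))
  where
  split : ∀ k′ a d → suc (k′ + a + d) + suc (k′ + a + d) ≡ suc (k′ + a) + suc k′ + (a + (d + d))
  split = solve-∀

peakView : ∀ {n ρ} → DyckPath ρ → length ρ ≡ n + n → 1 ≤ n → PeakView n ρ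
peakView {n} {ρ} dy len pos with runsOf ρ
... | runs j zero (U ∷ _) () _
... | runs j zero (D ∷ _) _ ()
... | runs j zero [] _ _ with dyck-climb j dy
...   | done = ⊥-elim (<⇒≢ (≤-trans pos (m≤m+n n n)) len)
peakView {n} {ρ} dy len pos | runs j (suc k′) π _ noD with dyck-fall (suc k′) (dyck-climb j dy)
...   | a , refl , dyπ = atPeak (subst (_≤ n) (leadU-peak k′ a π) (leadU-half dy len)) len
  where
  atPeak : ∀ {n} → suc (k′ + a) ≤ n → length (peakPath k′ a π) ≡ n + n → PeakView n (peakPath k′ a π)
  atPeak {n} j≤n len′ with n ∸ suc (k′ + a) | m+[n∸m]≡n j≤n
  ... | d | refl = peak k′ a d π dyπ (peak-length k′ a d (length π) (trans (sym (length-runs (suc (k′ + a)) (suc k′) π)) len′)) noD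

tripleFalls-climb : ∀ j w → tripleFalls (replicate j U ++ w) ≡ tripleFalls w
tripleFalls-climb zero    w = refl
tripleFalls-climb (suc j) w = tripleFalls-climb j w

valleys-climb : ∀ j w → valleys (replicate j U ++ w) ≡ valleys w
valleys-climb zero    w = refl
valleys-climb (suc j) w = valleys-climb j w

tripleFalls-fall : ∀ k w → leadD w ≡ 0 → tripleFalls (replicate (suc k) D ++ w) ≡ (k ∸ 1) + tripleFalls w
tripleFalls-fall k             (D ∷ w) ()
tripleFalls-fall zero          []      _   = refl
tripleFalls-fall zero          (U ∷ w) _   = refl
tripleFalls-fall (suc zero)    []      _   = refl
tripleFalls-fall (suc zero)    (U ∷ w) _   = refl
tripleFalls-fall (suc (suc k)) w       noD = cong suc (tripleFalls-fall (suc k) w noD)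

valleys-fall-end : ∀ k → valleys (replicate k D ++ []) ≡ 0
valleys-fall-end zero          = refl
valleys-fall-end (suc zero)    = refl
valleys-fall-end (suc (suc k)) = valleys-fall-end (suc k)

valleys-fall-up : ∀ k w → valleys (replicate (suc k) D ++ U ∷ w) ≡ suc (valleys (U ∷ w))
valleys-fall-up zero    w = refl
valleys-fall-up (suc k) w = valleys-fall-up k w

-- The word built by case (a) of Ψ from j, k and the inner word τ, verbatim.
caseA : ℕ → ℕ → ℕ → List ℕ → List ℕ
caseA n j k τ =
  ((suc (n + n) ∸ j) ∷ map (λ i → suc (suc (n + n)) ∸ i) (range 2 k))
  ++ embed (keep (n + n) k (suc (n + n) ∸ k) j (suc (n + n) ∸ j)) τ
  ++ (reverse (range 1 (k ∸ 1)) ++ (j ∷ []))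

Within : ℕ → ℕ → Set
Within m v = 1 ≤ v × v ≤ m

record Good (n : ℕ) (ρ : List Step) (σ : List ℕ) : Set where
  field
    descents : des σ ≡ 2 * (tripleFalls ρ + valleys ρ) + 1
    inner    : List ℕ
    ends     : σ ≡ (suc (n + n) ∸ leadU ρ) ∷ inner ++ leadU ρ ∷ []
    bounded  : All (Within (n + n)) σ

-- Ψ of the Dyck path peakPath k′ a π of length 2n (n = k′ + a + d + 1) is the frame
--   Y, 2n, …, 2n − k′ + 1, [τ embedded into S], k′, …, 1, J
-- where J = k′ + a + 1 is the peak height, Y = 2n + 1 − J, HI = 2n − k′, and
-- τ = Ψ(U^a π) is placed order-isomorphically on S = [k′ + 1, HI] ∖ {J, Y}.
module Frame (k′ a d : ℕ) where

  n J Y HI : ℕ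
  n  = suc (k′ + a + d)
  J  = suc (k′ + a)
  Y  = suc J + (d + d)
  HI = Y + a

  S : List ℕ
  S = rangeLen (suc k′) a ++ rangeLen (suc J) (d + d) ++ rangeLen (suc Y) a

  frame : List ℕ → List ℕ
  frame τ = Y ∷ downRun (suc HI) k′ ++ embed S τ ++ downRun 1 k′ ++ J ∷ []

  L : ℕ
  L = (a + d) + (a + d)

  2n≡HI+k′ : n + n ≡ HI + k′
  2n≡HI+k′ = sizes k′ a d
    where
    sizes : ∀ k′ a d → suc (k′ + a + d) + suc (k′ + a + d) ≡ suc (suc (k′ + a)) + (d + d) + a + k′
    sizes = solve-∀

  Y-eq : suc (n + n) ∸ J ≡ Y
  Y-eq = trans (cong (_∸ J) (sizes k′ a d)) (m+n∸n≡m Y J)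
    where
    sizes : ∀ k′ a d → suc (suc (k′ + a + d) + suc (k′ + a + d)) ≡ suc (suc (k′ + a)) + (d + d) + suc (k′ + a)
    sizes = solve-∀

  HI-eq : suc (n + n) ∸ suc k′ ≡ HI
  HI-eq = trans (cong (_∸ suc k′) (trans (cong suc 2n≡HI+k′) (sym (+-suc HI k′)))) (m+n∸n≡m HI (suc k′))

  2n+3≡ : suc (suc (suc (n + n))) ≡ suc HI + (2 + k′)
  2n+3≡ = sizes k′ a d
    where
    sizes : ∀ k′ a d → suc (suc (suc (suc (k′ + a + d) + suc (k′ + a + d))))
                       ≡ suc (suc (suc (k′ + a)) + (d + d) + a) + (2 + k′)
    sizes = solve-∀

  k′<J : k′ < J
  k′<J = s≤s (m≤m+n k′ a)

  J<Y : J < Y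
  J<Y = s≤s (m≤m+n J (d + d))

  Y≤1+HI : Y ≤ suc HI
  Y≤1+HI = ≤-trans (m≤m+n Y a) (n≤1+n HI)

  HI≤2n : HI ≤ n + n
  HI≤2n = subst (HI ≤_) (sym 2n≡HI+k′) (m≤m+n HI k′)

  Y≤2n : Y ≤ n + n
  Y≤2n = ≤-trans (m≤m+n Y a) HI≤2n

  S-keep : keep (n + n) (suc k′) HI J Y ≡ S
  S-keep = keep-three-runs k′ a (d + d) a k′ refl refl refl 2n≡HI+k′

  S-length : length S ≡ L
  S-length = begin
    length S  ≡⟨ length-++ (rangeLen (suc k′) a) ⟩
    length (rangeLen (suc k′) a) + length (rangeLen (suc J) (d + d) ++ rangeLen (suc Y) a)
      ≡⟨ cong₂ _+_ (length-rangeLen (suc k′) a)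
                   (trans (length-++ (rangeLen (suc J) (d + d)))
                          (cong₂ _+_ (length-rangeLen (suc J) (d + d)) (length-rangeLen (suc Y) a))) ⟩
    a + ((d + d) + a) ≡⟨ sizes a d ⟩
    L ∎
    where
    open ≡-Reasoning
    sizes : ∀ a d → a + ((d + d) + a) ≡ (a + d) + (a + d)
    sizes = solve-∀

  S-increasing : Linked _<_ S
  S-increasing = subst (Linked _<_) S-keep (keep-increasing (n + n) (suc k′) HI J Y)

  S-bounded : All (Within (n + n)) S
  S-bounded = subst (All (Within (n + n))) S-keep
    (All.map (λ (p<v , v≤HI) → ≤-trans (s≤s z≤n) p<v , ≤-trans v≤HI HI≤2n) (keep-bounds (n + n) (suc k′) HI J Y))

  S-below-Y : ∀ i → i < a + (d + d) → nth S i < Y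
  S-below-Y i i< = subst (_< Y) (sym nth≡) (All-nth i belowY i<AB)
    where
    A = rangeLen (suc k′) a
    B = rangeLen (suc J) (d + d)
    C = rangeLen (suc Y) a
    lengthAB : length (A ++ B) ≡ a + (d + d)
    lengthAB = trans (length-++ A) (cong₂ _+_ (length-rangeLen (suc k′) a) (length-rangeLen (suc J) (d + d)))
    belowY : All (_< Y) (A ++ B)
    belowY = ++⁺ (All.map (λ (_ , v<J) → <-trans v<J J<Y) (All-rangeLen (suc k′) a))
                 (All.map proj₂ (All-rangeLen (suc J) (d + d)))
    i<AB : i < length (A ++ B)
    i<AB = subst (i <_) (sym lengthAB) i<
    nth≡ : nth S i ≡ nth (A ++ B) i
    nth≡ = trans (cong (λ w → nth w i) (sym (++-assoc A B C))) (nth-++ˡ (A ++ B) C i i<AB)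

  S-middle : ∀ u → u < d + d → nth S (a + u) ≡ suc J + u
  S-middle u u< = begin
    nth (A ++ B ++ C) (a + u)               ≡⟨ cong (λ z → nth (A ++ B ++ C) (z + u)) (sym (length-rangeLen (suc k′) a)) ⟩
    nth (A ++ B ++ C) (length A + u)        ≡⟨ nth-++ʳ A (B ++ C) u ⟩
    nth (B ++ C) u                          ≡⟨ nth-++ˡ B C u (subst (u <_) (sym (length-rangeLen (suc J) (d + d))) u<) ⟩
    nth B u                                 ≡⟨ nth-rangeLen (suc J) (d + d) u u< ⟩
    suc J + u                               ∎
    where
    open ≡-Reasoning
    A = rangeLen (suc k′) a
    B = rangeLen (suc J) (d + d)
    C = rangeLen (suc Y) a

  g : ℕ → ℕ
  g t = nth S (t ∸ 1)

  g-increasing : ∀ {s t} → Within L s → Within L t → s < t → g s < g t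
  g-increasing {zero}  {_}     (() , _) _         _
  g-increasing {suc s} {zero}  _        (() , _)  _
  g-increasing {suc s} {suc t} _        (_ , t<L) (s≤s s<t) =
    nth-increasing S-increasing s<t (subst (t <_) (sym S-length) t<L)

  g-bounded : ∀ {t} → Within L t → Within (n + n) (g t)
  g-bounded {suc t} (_ , t<L) = All-nth t S-bounded (subst (t <_) (sym S-length) t<L)

  g-below-Y : ∀ t → 1 ≤ t → t ≤ a + (d + d) → g t < Y
  g-below-Y (suc t) _ t< = S-below-Y t t<

  g-above-J : ∀ u → u < d + d → J < g (a + suc u)
  g-above-J u u< = subst (J <_) (sym (trans (cong (λ z → nth S (z ∸ 1)) (+-suc a u)) (S-middle u u<)))
                         (s≤s (m≤m+n J u))

  des-embed : ∀ {τ} → All (Within L) τ → des (embed S τ) ≡ des τ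
  des-embed = des-relabel (Within L) g g-increasing

  frame-ends : ∀ τ → frame τ ≡ Y ∷ (downRun (suc HI) k′ ++ embed S τ ++ downRun 1 k′) ++ J ∷ []
  frame-ends τ = cong (Y ∷_) (sym (trans (++-assoc top (embed S τ ++ bottom) (J ∷ []))
                                         (cong (top ++_) (++-assoc (embed S τ) bottom (J ∷ [])))))
    where
    top = downRun (suc HI) k′
    bottom = downRun 1 k′

  frame-bounded : ∀ τ → All (Within L) τ → All (Within (n + n)) (frame τ)
  frame-bounded τ bτ =
    (s≤s z≤n , Y≤2n) ∷ ++⁺ top (++⁺ (map⁺ (All.map g-bounded bτ)) (++⁺ bottom ((s≤s z≤n , J≤2n) ∷ [])))
    where
    J≤2n : J ≤ n + n
    J≤2n = ≤-trans (<⇒≤ J<Y) Y≤2n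
    top : All (Within (n + n)) (downRun (suc HI) k′)
    top = All.map (λ {v} (HI<v , v<) → ≤-trans (s≤s z≤n) HI<v , ≤-pred (subst (v <_) (cong suc (sym 2n≡HI+k′)) v<))
                  (All-downRun (suc HI) k′)
    bottom : All (Within (n + n)) (downRun 1 k′)
    bottom = All.map (λ (1≤v , v<1+k′) → 1≤v , ≤-trans (≤-pred v<1+k′) (≤-trans (<⇒≤ k′<J) J≤2n)) (All-downRun 1 k′)

  frame-flat : des (frame []) ≡ 2 * (k′ ∸ 1) + 1
  frame-flat = des-emptyFrame Y (suc HI) k′ J Y≤1+HI J<Y (<⇒≤ k′<J)

  -- An inner word τ that starts at h ≤ a + 2d and ends at a + u + 1 with u < 2d is
  -- embedded below Y and ends above J, so it adds exactly one descent on each side.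
  frame-des : ∀ h inner l u → l ≡ a + suc u → u < d + d → h ≤ a + (d + d) → All (Within L) (h ∷ inner ++ l ∷ []) →
              des (frame (h ∷ inner ++ l ∷ [])) ≡ 2 * (k′ ∸ 1) + 2 + des (h ∷ inner ++ l ∷ [])
  frame-des h inner _ u refl u< h≤ bτ@((1≤h , _) ∷ _) = begin
      des (Y ∷ downRun (suc HI) k′ ++ g h ∷ rest ++ downRun 1 k′ ++ J ∷ [])
    ≡⟨ des-openRun Y (suc HI) k′ (g h) _ Y≤1+HI (g-below-Y h 1≤h h≤) ⟩
      (k′ ∸ 1) + 1 + des ((g h ∷ rest) ++ downRun 1 k′ ++ J ∷ [])
    ≡⟨ cong ((k′ ∸ 1) + 1 +_) (des-closeRun (g h) rest k′ J (<⇒≤ k′<J) J<last) ⟩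
      (k′ ∸ 1) + 1 + (des (g h ∷ rest) + 1 + (k′ ∸ 1))
    ≡⟨ cong (λ t → (k′ ∸ 1) + 1 + (t + 1 + (k′ ∸ 1))) (des-embed bτ) ⟩
      (k′ ∸ 1) + 1 + (des τ + 1 + (k′ ∸ 1))
    ≡⟨ arrange (k′ ∸ 1) (des τ) ⟩
      2 * (k′ ∸ 1) + 2 + des τ ∎
    where
    open ≡-Reasoning
    τ = h ∷ inner ++ a + suc u ∷ []
    rest = map g (inner ++ a + suc u ∷ [])
    J<last : J < lastOr (g h) rest
    J<last = subst (J <_) (sym (trans (cong (lastOr (g h)) (map-++ g inner _)) (lastOr-snoc (g h) (map g inner) _)))
                   (g-above-J u u<)
    arrange : ∀ r t → r + 1 + (t + 1 + r) ≡ 2 * r + 2 + t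
    arrange = solve-∀

  frame-good : ∀ π τ → All (Within L) τ →
               des (frame τ) ≡ 2 * (tripleFalls (peakPath k′ a π) + valleys (peakPath k′ a π)) + 1 →
               Good n (peakPath k′ a π) (frame τ)
  frame-good π τ bτ dq = record
    { descents = dq
    ; inner    = middle
    ; ends     = subst (λ j → frame τ ≡ (suc (n + n) ∸ j) ∷ middle ++ j ∷ []) (sym (leadU-peak k′ a π))
                       (trans (frame-ends τ) (cong (λ y → y ∷ middle ++ J ∷ []) (sym Y-eq)))
    ; bounded  = frame-bounded τ bτ
    }
    where
    middle = downRun (suc HI) k′ ++ embed S τ ++ downRun 1 k′

  caseA-frame : ∀ τ → caseA n J (suc k′) τ ≡ frame τ
  caseA-frame τ rewrite HI-eq | Y-eq | S-keep | reverse-rangeLen 1 k′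
                      | reflect-rangeLen (suc (suc (n + n))) (suc HI) 2 k′ 2n+3≡ = refl

Ψ-peak : ∀ f k′ a d π → leadD π ≡ 0 →
         psiF (suc f) (suc (k′ + a + d)) (peakPath k′ a π) ≡
         caseA (suc (k′ + a + d)) (suc (k′ + a)) (suc k′) (psiF f (a + d) (replicate a U ++ π))
Ψ-peak f k′ a d π noD
  rewrite leadU-run (k′ + a) (replicate (suc k′) D ++ π) refl
        | dropN-run (k′ + a) U (replicate (suc k′) D ++ π)
        | leadD-run k′ π noD
        | dropN-run k′ D π
        | Equivalence.to T-≡ (<⇒<ᵇ (s≤s (m≤m+n (k′ + a) d)))
        | m+n∸m≡n k′ a
        | trans (cong (_∸ k′) (+-assoc k′ a d)) (m+n∸m≡n k′ (a + d)) = refl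

stat-peak-end : ∀ k′ a → tripleFalls (peakPath k′ a []) + valleys (peakPath k′ a []) ≡ k′ ∸ 1
stat-peak-end k′ a = begin
  tripleFalls (peakPath k′ a []) + valleys (peakPath k′ a [])
    ≡⟨ cong₂ _+_ (trans (tripleFalls-climb (suc (k′ + a)) _) (tripleFalls-fall k′ [] refl))
                 (trans (valleys-climb (suc (k′ + a)) _) (valleys-fall-end (suc k′))) ⟩
  (k′ ∸ 1) + 0 + 0
    ≡⟨ trans (+-identityʳ _) (+-identityʳ _) ⟩
  k′ ∸ 1 ∎
  where open ≡-Reasoning

stat-peak-up : ∀ k′ a w →
  tripleFalls (peakPath k′ a (U ∷ w)) + valleys (peakPath k′ a (U ∷ w)) ≡
  (k′ ∸ 1) + suc (tripleFalls (replicate a U ++ U ∷ w) + valleys (replicate a U ++ U ∷ w))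
stat-peak-up k′ a w = begin
  tripleFalls (peakPath k′ a (U ∷ w)) + valleys (peakPath k′ a (U ∷ w))
    ≡⟨ cong₂ _+_ (trans (tripleFalls-climb (suc (k′ + a)) _) (tripleFalls-fall k′ (U ∷ w) refl))
                 (trans (valleys-climb (suc (k′ + a)) _) (valleys-fall-up k′ w)) ⟩
  (k′ ∸ 1) + tripleFalls (U ∷ w) + suc (valleys (U ∷ w))
    ≡⟨ regroup (k′ ∸ 1) (tripleFalls (U ∷ w)) (valleys (U ∷ w)) ⟩
  (k′ ∸ 1) + suc (tripleFalls (U ∷ w) + valleys (U ∷ w))
    ≡⟨ cong (λ t → (k′ ∸ 1) + suc t) (sym (cong₂ _+_ (tripleFalls-climb a (U ∷ w)) (valleys-climb a (U ∷ w)))) ⟩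
  (k′ ∸ 1) + suc (tripleFalls (replicate a U ++ U ∷ w) + valleys (replicate a U ++ U ∷ w)) ∎
  where
  open ≡-Reasoning
  regroup : ∀ r t v → r + t + suc v ≡ r + suc (t + v)
  regroup = solve-∀

psiF-empty : ∀ f n → psiF f n [] ≡ []
psiF-empty zero    n = refl
psiF-empty (suc f) n = refl

good-flat : ∀ k′ f → Good (suc (k′ + 0 + 0)) (peakPath k′ 0 []) (Frame.frame k′ 0 0 (psiF f 0 []))
good-flat k′ f rewrite psiF-empty f 0 =
  frame-good [] [] [] (trans frame-flat (cong (λ t → 2 * t + 1) (sym (stat-peak-end k′ 0))))
  where open Frame k′ 0 0

-- The first letter of τ
-- is at most a + 2d and its last letter is a + u + 1 with u = leadU w < d, because the
-- first peak of U^a U w is at most half its length.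
good-step : ∀ k′ a d w τ → leadU (replicate a U ++ U ∷ w) ≤ a + d →
            Good (a + d) (replicate a U ++ U ∷ w) τ →
            Good (suc (k′ + a + d)) (peakPath k′ a (U ∷ w)) (Frame.frame k′ a d τ)
good-step k′ a d w τ l≤N iv = frame-good (U ∷ w) τ bounded (begin
    des (frame τ)
      ≡⟨ subst (λ σ → des (frame σ) ≡ 2 * (k′ ∸ 1) + 2 + des σ) (sym ends)
               (frame-des h inner l u l≡ u<2d h≤ (subst (All (Within L)) ends bounded)) ⟩
    2 * (k′ ∸ 1) + 2 + des τ
      ≡⟨ cong (2 * (k′ ∸ 1) + 2 +_) descents ⟩
    2 * (k′ ∸ 1) + 2 + (2 * stat′ + 1)
      ≡⟨ arrange (k′ ∸ 1) stat′ ⟩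
    2 * ((k′ ∸ 1) + suc stat′) + 1
      ≡⟨ cong (λ t → 2 * t + 1) (sym (stat-peak-up k′ a w)) ⟩
    2 * (tripleFalls (peakPath k′ a (U ∷ w)) + valleys (peakPath k′ a (U ∷ w))) + 1 ∎)
  where
  open ≡-Reasoning
  open Frame k′ a d
  open Good iv
  ρ′ = replicate a U ++ U ∷ w
  stat′ = tripleFalls ρ′ + valleys ρ′
  l = leadU ρ′
  u = leadU w
  h = suc L ∸ l
  l≡ : l ≡ a + suc u
  l≡ = leadU-climb a (U ∷ w)
  u<2d : u < d + d
  u<2d = ≤-trans (+-cancelˡ-≤ a _ _ (subst (_≤ a + d) l≡ l≤N)) (m≤m+n d d)
  h≤ : h ≤ a + (d + d)
  h≤ = m≤n+o⇒m∸n≤o (suc L) l (subst (λ z → suc L ≤ z + (a + (d + d))) (sym l≡)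
         (subst (_≤ (a + suc u) + (a + (d + d))) (sym (sizes a d))
           (+-monoˡ-≤ (a + (d + d)) (subst (suc a ≤_) (sym (+-suc a u)) (s≤s (m≤m+n a u))))))
    where
    sizes : ∀ a d → suc ((a + d) + (a + d)) ≡ suc a + (a + (d + d))
    sizes = solve-∀
  arrange : ∀ r t → 2 * r + 2 + (2 * t + 1) ≡ 2 * (r + suc t) + 1
  arrange = solve-∀

nonempty-rest : ∀ a d (w : List Step) → length (U ∷ w) ≡ a + (d + d) → 1 ≤ a + d
nonempty-rest (suc a) d       w _  = s≤s z≤n
nonempty-rest zero    (suc d) w _  = s≤s z≤n
nonempty-rest zero    zero    w ()

GoodBelow : ℕ → Set
GoodBelow f = ∀ n ρ → n < f → DyckPath ρ → length ρ ≡ n + n → 1 ≤ n → Good n ρ (psiF f n ρ)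

good-peak : ∀ f → GoodBelow f → ∀ k′ a d π → DyckFrom a 0 π → length π ≡ a + (d + d) → leadD π ≡ 0 →
            suc (k′ + a + d) ≤ f → Good (suc (k′ + a + d)) (peakPath k′ a π) (Frame.frame k′ a d (psiF f (a + d) (replicate a U ++ π)))
good-peak f ih k′ .0 zero    []      done refl _  _   = good-flat k′ f
good-peak f ih k′ .0 (suc d) []      done ()   _  _
good-peak f ih k′ a  d       (D ∷ w) _    _    () _
good-peak f ih k′ a  d       (U ∷ w) dyπ  lenπ _  n≤f =
  good-step k′ a d w _ (leadU-half dyρ′ lenρ′) (ih (a + d) ρ′ N<f dyρ′ lenρ′ N≥1)
  where
  ρ′ = replicate a U ++ U ∷ w
  dyρ′ : DyckPath ρ′
  dyρ′ = climb-dyck a dyπ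
  lenρ′ : length ρ′ ≡ (a + d) + (a + d)
  lenρ′ = trans (length-++ (replicate a U)) (trans (cong₂ _+_ (length-replicate a) lenπ) (sizes a d))
    where
    sizes : ∀ a d → a + (a + (d + d)) ≡ (a + d) + (a + d)
    sizes = solve-∀
  N<f : a + d < f
  N<f = <-≤-trans (s≤s (subst (a + d ≤_) (sym (+-assoc k′ a d)) (m≤n+m (a + d) k′))) n≤f
  N≥1 : 1 ≤ a + d
  N≥1 = nonempty-rest a d w lenπ

Ψ-good : ∀ f → GoodBelow f
Ψ-good (suc f) n ρ (s≤s n≤f) dy len pos with peakView dy len pos
... | peak k′ a d π dyπ lenπ noD
  rewrite Ψ-peak f k′ a d π noD | Frame.caseA-frame k′ a d (psiF f (a + d) (replicate a U ++ π)) =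
  good-peak f (Ψ-good f) k′ a d π dyπ lenπ noD n≤f

-- The descent formula is the first component of Good.
proposition10 : (n : ℕ) → 1 ≤ n → (σ : List ℕ) → InC (2 * n) σ →
                (π : List Step) → length π ≡ 2 * n → DyckPath π → Ψ n π ≡ σ →
                des σ ≡ 2 * (tripleFalls π + valleys π) + 1
proposition10 n pos _ _ π len dy refl =
  Good.descents (Ψ-good (suc n) n π ≤-refl dy (trans len (cong (n +_) (+-identityʳ n))) pos)
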